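{- Let $N$ be a positive integer. The unique (up to translation) smallest polyomino which contains at least $N^2$ instances of the T tetromino is the ziggurat of height $N+1$.
   Context: Cells are the unit squares of the square lattice, indexed by integer coordinates $(x,y)$ with $y$ increasing upward. A polyomino is a finite nonempty edge-connected set of cells; its size is its number of cells; polyominoes are considered up to translation. The T tetromino is the set $\{(-1,0),(0,0),(1,0),(0,1)\}$ (three cells in a row with one cell directly above the middle one); only this orientation is considered. An instance of a shape is a translate of it; an instance in $P$ is one contained in $P$. The ziggurat of height $M$ is the polyomino whose rows, from top to bottom, consist of $1,3,5,\dots,2M-1$ consecutive cells, all centered on a common vertical axis (i.e., rows $\{(x,-j): |x|\le j\}$ for $j=0,\dots,M-1$); it has $M^2$ cells. -}

module Defs where

open import Data.Nat using (ℕ; zero; suc; _≤_) renaming (_+_ to _+ℕ_; _*_ to _*ℕ_)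
open import Data.Integer using (ℤ; +_; -_; _+_; _-_; ∣_∣)
open import Data.Product using (_×_; _,_; ∃-syntax)
open import Data.List using (List; []; _∷_; length; map; concatMap; upTo)
open import Data.List.Membership.Propositional using (_∈_)
open import Data.List.Relation.Unary.All using (All)
open import Data.List.Relation.Unary.Unique.Propositional using (Unique)
open import Relation.Binary.PropositionalEquality using (_≡_)

-- A cell (x , y) of the square lattice, y increasing upward.
Cell : Set
Cell = ℤ × ℤ

shift : Cell → Cell → Cell
shift (a , b) (x , y) = (a + x , b + y)

Adjacent : Cell → Cell → Set
Adjacent (x , y) (x' , y') = ∣ x - x' ∣ +ℕ ∣ y - y' ∣ ≡ 1

data Walk (P : List Cell) : Cell → Cell → Set where
  here : ∀ {c} → c ∈ P → Walk P c c
  step : ∀ {c d e} → c ∈ P → Adjacent c d → Walk P d e → Walk P c e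

EdgeConnected : List Cell → Set
EdgeConnected P = ∀ {a b} → a ∈ P → b ∈ P → Walk P a b

-- A polyomino is a finite nonempty edge-connected set of cells, represented as a
-- duplicate-free list of cells; its size is then the length of the list.
record IsPolyomino (P : List Cell) : Set where
  field
    nonempty  : ∃[ c ] (c ∈ P)
    distinct  : Unique P
    connected : EdgeConnected P

size : List Cell → ℕ
size = length

IsTranslateOf : List Cell → List Cell → Set
IsTranslateOf P Q = ∃[ t ] (∀ c → (c ∈ P → c ∈ map (shift t) Q) × (c ∈ map (shift t) Q → c ∈ P))

-- The T tetromino {(-1,0),(0,0),(1,0),(0,1)} (only this orientation).
T-tetromino : List Cell
T-tetromino = (- + 1 , + 0) ∷ (+ 0 , + 0) ∷ (+ 1 , + 0) ∷ (+ 0 , + 1) ∷ []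

InstanceIn : List Cell → Cell → Set
InstanceIn P t = All (λ c → shift t c ∈ P) T-tetromino

AtLeastInstances : ℕ → List Cell → Set
AtLeastInstances k P = ∃[ ts ] (Unique ts × k ≤ length ts × All (InstanceIn P) ts)

-- The ziggurat of height M: rows {(x , -j) : |x| ≤ j} for j = 0 .. M-1.
ziggurat : ℕ → List Cell
ziggurat M = concatMap (λ j → map (λ i → ((+ i) - (+ j) , - (+ j))) (upTo (suc (2 *ℕ j)))) (upTo M)

-- Scan P from its top row y downwards, with C a set of T-instances in P. Let D be the instances
-- centred in row y − 1: row y − 1 of P holds at least |D| + 2 cells (one beyond each end of D) and
-- row y at least |D| (their tops). Induction on the rows then shows that (P, C) is dominated by a
-- trapezoid with m + 1 rows of widths E, E + 2, …, where E ≥ the number of cells in the top row: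
-- |P| = |C| + 2m + E, |C| is at most the trapezoid's m(E + m − 1) instances, and when this is an
-- equality and the top row is a segment of E cells, P is exactly the trapezoid. With E = e + 1 this
-- gives 4|C| + e² ≤ (2m + e)², so |C| ≥ N² forces |P| ≥ (N + 1)², with equality only for e = 0,
-- m = N and |C| = N², i.e. when P is a translate of the ziggurat of height N + 1.

module Submission where

open import Defs
open import Data.Nat using (ℕ; zero; suc; _+_; _*_; _^_; _≤_; _<_; z≤n; s≤s)
import Data.Nat.Properties as ℕₚ
open import Data.Integer as ℤ using (ℤ; +_; -_; 0ℤ; 1ℤ; -1ℤ; pred; ∣_∣)
  renaming (suc to sucℤ; _+_ to _+ᶻ_; _-_ to _-ᶻ_; _≤_ to _≤ᶻ_; _<_ to _<ᶻ_)
import Data.Integer.Properties as ℤₚ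
import Data.Integer.Tactic.RingSolver as ℤ-Ring
import Data.Nat.Tactic.RingSolver as ℕ-Ring
open import Algebra.Properties.AbelianGroup ℤₚ.+-0-abelianGroup using (∙-cancelˡ; ∙-cancelʳ)
open import Data.Fin using (Fin; zero; suc)
open import Data.Fin.Properties using (injective⇒≤)
open import Data.Product using (_×_; _,_; proj₁; proj₂; ∃-syntax)
open import Data.Product.Properties using (≡-dec)
open import Data.Sum as Sum using (_⊎_; inj₁; inj₂; [_,_]′)
open import Data.List using (List; []; _∷_; _++_; [_]; length; lookup; filter; map; upTo; concatMap)
open import Data.List.Properties
  using ( length-++; length-map; length-upTo; ++-identityʳ; upTo-∷ʳ; concatMap-++
        ; length-filter; filter-some)
open import Data.List.Extrema ℤₚ.≤-totalOrder
  using (argmin; argmax; argmin-all; argmax-all; f[argmin]≤f[xs]; f[xs]≤f[argmax])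
open import Data.List.Membership.Propositional using (_∈_; find; lose)
open import Data.List.Membership.Propositional.Properties
  using ( ∈-lookup; ∈-length; ∈-filter⁺; ∈-filter⁻; ∈-map⁺; ∈-map⁻; ∈-upTo⁺; ∈-upTo⁻
        ; ∈-concatMap⁺; ∈-concatMap⁻)
open import Data.List.Relation.Unary.Any using (Any; here; there; index)
open import Data.List.Relation.Unary.Any.Properties using (lookup-index)
open import Data.List.Relation.Unary.All as All using (All; []; _∷_)
import Data.List.Relation.Unary.All.Properties as Allₚ
open import Data.List.Relation.Unary.AllPairs using ([]; _∷_)
open import Data.List.Relation.Unary.Unique.Propositional using (Unique)
import Data.List.Relation.Unary.Unique.Propositional.Properties as Uniqueₚ
open import Data.List.Relation.Binary.Subset.Propositional using (_⊆_)
open import Data.List.Relation.Binary.Subset.Propositional.Properties using (∈-∷⁺ʳ; ⊆[]⇒≡[])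
open import Function using (_∘_)
open import Level using (0ℓ)
open import Relation.Binary.Definitions using (DecidableEquality)
open import Relation.Binary.PropositionalEquality
  using (_≡_; _≢_; refl; sym; trans; cong; cong₂; subst; subst₂; module ≡-Reasoning)
open import Relation.Nullary using (¬_; yes; no; contradiction)
open import Relation.Unary using (Pred; Decidable; _≐_; _∪_)
open import Relation.Unary.Properties using (∁?; ≐-sym; ≐-trans)

-- Duplicate-free lists as finite sets

module _ {A : Set} where

  lookup-injective : ∀ {xs : List A} → Unique xs → ∀ {i j} → lookup xs i ≡ lookup xs j → i ≡ j
  lookup-injective {_ ∷ _} _          {zero}  {zero}  _  = refl
  lookup-injective {_ ∷ _} (x∉ ∷ _)   {zero}  {suc j} eq = contradiction eq (All.lookup x∉ (∈-lookup j))
  lookup-injective {_ ∷ _} (x∉ ∷ _)   {suc i} {zero}  eq =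
    contradiction (sym eq) (All.lookup x∉ (∈-lookup i))
  lookup-injective {_ ∷ _} (_ ∷ uniq) {suc i} {suc j} eq = cong suc (lookup-injective uniq eq)

  Unique-⊆⇒length≤ : ∀ {xs ys : List A} → Unique xs → xs ⊆ ys → length xs ≤ length ys
  Unique-⊆⇒length≤ {xs} {ys} uniq xs⊆ys = injective⇒≤ {f = position} position-injective
    where
    position : Fin (length xs) → Fin (length ys)
    position i = index (xs⊆ys (∈-lookup i))
    position-injective : ∀ {i j} → position i ≡ position j → i ≡ j
    position-injective {i} {j} eq = lookup-injective uniq (trans (lookup-index (xs⊆ys (∈-lookup i)))
      (trans (cong (lookup ys) eq) (sym (lookup-index (xs⊆ys (∈-lookup j))))))

  module _ (_≟_ : DecidableEquality A) where
    open import Data.List.Membership.DecPropositional _≟_ using (_∈?_)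

    Unique-⊆-length≥⇒⊇ : ∀ {xs ys : List A} → Unique xs → xs ⊆ ys → length ys ≤ length xs →
                         ys ⊆ xs
    Unique-⊆-length≥⇒⊇ {xs} uniq xs⊆ys ys≤xs {z} z∈ys with z ∈? xs
    ... | yes z∈xs = z∈xs
    ... | no  z∉xs = contradiction (ℕₚ.≤-trans z∷xs≤ys ys≤xs) (ℕₚ.<-irrefl refl)
      where
      z∷xs≤ys = Unique-⊆⇒length≤ (Allₚ.¬Any⇒All¬ xs z∉xs ∷ uniq) (∈-∷⁺ʳ z∈ys xs⊆ys)

  module _ {P : Pred A 0ℓ} (P? : Decidable P) where

    length-filter-∁ : ∀ xs → length xs ≡ length (filter P? xs) + length (filter (∁? P?) xs)
    length-filter-∁ []       = refl
    length-filter-∁ (x ∷ xs) with P? x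
    ... | yes _ = cong suc (length-filter-∁ xs)
    ... | no  _ = trans (cong suc (length-filter-∁ xs)) (sym (ℕₚ.+-suc _ _))

    ∈-filter-∁ : ∀ xs → (_∈ xs) ≐ (_∈ filter P? xs) ∪ (_∈ filter (∁? P?) xs)
    ∈-filter-∁ xs = split , [ proj₁ ∘ ∈-filter⁻ P? , proj₁ ∘ ∈-filter⁻ (∁? P?) ]′
      where
      split : ∀ {x} → x ∈ xs → x ∈ filter P? xs ⊎ x ∈ filter (∁? P?) xs
      split {x} x∈xs with P? x
      ... | yes px = inj₁ (∈-filter⁺ P? x∈xs px)
      ... | no ¬px = inj₂ (∈-filter⁺ (∁? P?) x∈xs ¬px)

  empty-or-member : (xs : List A) → xs ≡ [] ⊎ ∃[ x ] (x ∈ xs)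
  empty-or-member []      = inj₁ refl
  empty-or-member (x ∷ _) = inj₂ (x , here refl)

∪-cong : ∀ {A : Set} {P P′ Q Q′ : Pred A 0ℓ} → P ≐ P′ → Q ≐ Q′ → P ∪ Q ≐ P′ ∪ Q′
∪-cong (P⊆ , ⊇P) (Q⊆ , ⊇Q) = Sum.map P⊆ Q⊆ , Sum.map ⊇P ⊇Q

_≟ᶜ_ : DecidableEquality Cell
_≟ᶜ_ = ≡-dec ℤ._≟_ ℤ._≟_

shift-injective : ∀ t {c d} → shift t c ≡ shift t d → c ≡ d
shift-injective (a , b) eq =
  cong₂ _,_ (∙-cancelˡ a _ _ (cong proj₁ eq)) (∙-cancelˡ b _ _ (cong proj₂ eq))

OnRow : ℤ → Pred Cell 0ℓ
OnRow y c = proj₂ c ≡ y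

onRow? : ∀ y → Decidable (OnRow y)
onRow? y c = proj₂ c ℤ.≟ y

row offRow : ℤ → List Cell → List Cell
row    y = filter (onRow? y)
offRow y = filter (∁? (onRow? y))

IsTopRow : List Cell → ℤ → Set
IsTopRow P y = Any (OnRow y) P × All (λ c → proj₂ c ≤ᶻ y) P

topRow : ∀ {P c} → c ∈ P → ∃[ y ] IsTopRow P y
topRow {P} {c} c∈P = proj₂ highest , lose highest∈P refl , f[xs]≤f[argmax] c P
  where
  highest = argmax proj₂ c P
  highest∈P = argmax-all proj₂ {P = _∈ P} c∈P (All.tabulate (λ x∈P → x∈P))

left right up : Cell → Cell
left  (x , y) = (pred x , y)
right (x , y) = (sucℤ x , y)
up    (x , y) = (x , sucℤ y)

T-cells : Cell → List Cell
T-cells t = left t ∷ t ∷ right t ∷ up t ∷ []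

map-shift-T : ∀ t → map (shift t) T-tetromino ≡ T-cells t
map-shift-T (x , y) =
  cong₂ _∷_ (cong₂ _,_ (ℤₚ.+-comm x -1ℤ) y+0≡y) (cong₂ _∷_ (cong₂ _,_ x+0≡x y+0≡y)
  (cong₂ _∷_ (cong₂ _,_ (ℤₚ.+-comm x 1ℤ) y+0≡y)
  (cong₂ _∷_ (cong₂ _,_ x+0≡x (ℤₚ.+-comm y 1ℤ)) refl)))
  where
  x+0≡x = ℤₚ.+-identityʳ x
  y+0≡y = ℤₚ.+-identityʳ y

instance⇒cells : ∀ {P t} → InstanceIn P t → All (_∈ P) (T-cells t)
instance⇒cells {P} {t} inst = subst (All (_∈ P)) (map-shift-T t) (Allₚ.map⁺ inst)

cells⇒instance : ∀ {P t} → All (_∈ P) (T-cells t) → InstanceIn P t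
cells⇒instance {P} {t} cells = Allₚ.map⁻ (subst (All (_∈ P)) (sym (map-shift-T t)) cells)

up-injective : ∀ {c d} → up c ≡ up d → c ≡ d
up-injective {_ , y} {_ , y′} eq =
  cong₂ _,_ (cong proj₁ eq)
            (trans (sym (ℤₚ.pred-suc y)) (trans (cong (pred ∘ proj₂) eq) (ℤₚ.pred-suc y′)))

NeighboursIn : List Cell → Cell → Set
NeighboursIn R c = left c ∈ R × c ∈ R × right c ∈ R

pred[i]<i : ∀ i → pred i <ᶻ i
pred[i]<i i = ℤₚ.i≤pred[j]⇒i<j ℤₚ.≤-refl

i<suc[i] : ∀ i → i <ᶻ sucℤ i
i<suc[i] i = ℤₚ.suc[i]≤j⇒i<j ℤₚ.≤-refl

neighbours⇒2+length≤ : ∀ {D R d} → Unique D → d ∈ D → (∀ {c} → c ∈ D → NeighboursIn R c) →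
                       2 + length D ≤ length R
neighbours⇒2+length≤ {D} {R} {d} D-unique d∈D neighbours =
  Unique-⊆⇒length≤ ends∷D-unique ends∷D⊆R
  where
  leftmost  = argmin proj₁ d D
  rightmost = argmax proj₁ d D
  leftmost∈D  = argmin-all proj₁ {P = _∈ D} d∈D (All.tabulate (λ c∈D → c∈D))
  rightmost∈D = argmax-all proj₁ {P = _∈ D} d∈D (All.tabulate (λ c∈D → c∈D))
  leftmost≤ : All (λ c → proj₁ leftmost ≤ᶻ proj₁ c) D
  leftmost≤ = f[argmin]≤f[xs] {f = proj₁} d D
  ≤rightmost : All (λ c → proj₁ c ≤ᶻ proj₁ rightmost) D
  ≤rightmost = f[xs]≤f[argmax] {f = proj₁} d D
  beyond-left : All (left leftmost ≢_) D
  beyond-left = All.map (λ l≤c eq → ℤₚ.<⇒≱ (subst (_<ᶻ _) (cong proj₁ eq) (pred[i]<i _)) l≤c)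
                        leftmost≤
  beyond-right : All (right rightmost ≢_) D
  beyond-right = All.map (λ c≤r eq → ℤₚ.<⇒≱ (subst (_ <ᶻ_) (cong proj₁ eq) (i<suc[i] _)) c≤r)
                         ≤rightmost
  ends-distinct : left leftmost ≢ right rightmost
  ends-distinct = ℤₚ.<⇒≢ (ℤₚ.<-trans (pred[i]<i _)
                    (ℤₚ.≤-<-trans (All.lookup leftmost≤ rightmost∈D) (i<suc[i] _))) ∘ cong proj₁
  ends∷D-unique : Unique (left leftmost ∷ right rightmost ∷ D)
  ends∷D-unique = (ends-distinct ∷ beyond-left) ∷ beyond-right ∷ D-unique
  ends∷D⊆R : (left leftmost ∷ right rightmost ∷ D) ⊆ R
  ends∷D⊆R (here refl)         = proj₁ (neighbours leftmost∈D)
  ends∷D⊆R (there (here refl)) = proj₂ (proj₂ (neighbours rightmost∈D))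
  ends∷D⊆R (there (there c∈D)) = proj₁ (proj₂ (neighbours c∈D))

segment : ℤ → ℤ → ℕ → List Cell
segment x y w = map (λ j → (x +ᶻ + j , y)) (upTo w)

∈-segment⁺ : ∀ {x y w j} → j < w → (x +ᶻ + j , y) ∈ segment x y w
∈-segment⁺ {x} {y} j<w = ∈-map⁺ (λ j → (x +ᶻ + j , y)) (∈-upTo⁺ j<w)

∈-segment⁻ : ∀ {x y w c} → c ∈ segment x y w → ∃[ j ] (j < w × c ≡ (x +ᶻ + j , y))
∈-segment⁻ c∈seg with j , j∈upTo , refl ← ∈-map⁻ _ c∈seg = j , ∈-upTo⁻ j∈upTo , refl

segment-unique : ∀ x y w → Unique (segment x y w)
segment-unique x y w =
  Uniqueₚ.map⁺ (ℤₚ.+-injective ∘ ∙-cancelˡ x _ _ ∘ cong proj₁) (Uniqueₚ.upTo⁺ w)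

length-segment : ∀ x y w → length (segment x y w) ≡ w
length-segment x y w = trans (length-map _ (upTo w)) (length-upTo w)

segment-cong : ∀ {x x′ y y′ w w′} → x ≡ x′ → y ≡ y′ → w ≡ w′ →
               segment x y w ≡ segment x′ y′ w′
segment-cong refl refl refl = refl

segment⊆row : ∀ {x y w P} → segment x y w ⊆ P → segment x y w ⊆ row y P
segment⊆row {x} {y} {w} seg⊆P c∈seg with _ , _ , refl ← ∈-segment⁻ {x} {y} {w} c∈seg =
  ∈-filter⁺ (onRow? y) (seg⊆P c∈seg) refl

Trapezoid : ℤ → ℤ → ℕ → ℕ → Pred Cell 0ℓ
Trapezoid x y w h c = ∃[ i ] (i < h × c ∈ segment (x -ᶻ + i) (y -ᶻ + i) (w + 2 * i))

Trapezoid-suc : ∀ x y w h →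
                Trapezoid x y w (suc h) ≐ (_∈ segment x y w) ∪ Trapezoid (pred x) (pred y) (2 + w) h
Trapezoid-suc x y w h = split , join
  where
  Top∪Below = (_∈ segment x y w) ∪ Trapezoid (pred x) (pred y) (2 + w) h
  one-down : ∀ (x i : ℤ) → x -ᶻ (1ℤ +ᶻ i) ≡ (-1ℤ +ᶻ x) -ᶻ i
  one-down = ℤ-Ring.solve-∀
  wider : ∀ w i → w + 2 * suc i ≡ 2 + w + 2 * i
  wider = ℕ-Ring.solve-∀
  top : segment (x -ᶻ + 0) (y -ᶻ + 0) (w + 2 * 0) ≡ segment x y w
  top = segment-cong (ℤₚ.+-identityʳ x) (ℤₚ.+-identityʳ y) (ℕₚ.+-identityʳ w)
  below : ∀ i → segment (x -ᶻ + suc i) (y -ᶻ + suc i) (w + 2 * suc i)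
              ≡ segment (pred x -ᶻ + i) (pred y -ᶻ + i) (2 + w + 2 * i)
  below i = segment-cong (one-down x (+ i)) (one-down y (+ i)) (wider w i)
  split : ∀ {c} → Trapezoid x y w (suc h) c → Top∪Below c
  split (zero  , _         , c∈) = inj₁ (subst (_ ∈_) top c∈)
  split (suc i , s≤s i<h , c∈) = inj₂ (i , i<h , subst (_ ∈_) (below i) c∈)
  join : ∀ {c} → Top∪Below c → Trapezoid x y w (suc h) c
  join (inj₁ c∈)              = zero , s≤s z≤n , subst (_ ∈_) (sym top) c∈
  join (inj₂ (i , i<h , c∈)) = suc i , s≤s i<h , subst (_ ∈_) (sym (below i)) c∈

Trapezoid-one : ∀ x y w → Trapezoid x y w 1 ≐ (_∈ segment x y w)
Trapezoid-one x y w = only-top , λ c∈ → proj₂ (Trapezoid-suc x y w 0) (inj₁ c∈)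
  where
  only-top : ∀ {c} → Trapezoid x y w 1 c → c ∈ segment x y w
  only-top t with proj₁ (Trapezoid-suc x y w 0) t
  ... | inj₁ c∈ = c∈
  ... | inj₂ (_ , () , _)

Trapezoid-by-rows : ∀ {P x y w h} → (_∈ row y P) ≐ (_∈ segment x y w) →
                    (_∈ offRow y P) ≐ Trapezoid (pred x) (pred y) (2 + w) h →
                    (_∈ P) ≐ Trapezoid x y w (suc h)
Trapezoid-by-rows {P} {x} {y} {w} {h} top rest =
  ≐-trans (∈-filter-∁ (onRow? y) P)
          (≐-trans (∪-cong top rest) (≐-sym (Trapezoid-suc x y w h)))

segment-widen : ∀ {D R x y a} → 1 ≤ a → segment x y a ⊆ D →
                (∀ {c} → c ∈ D → NeighboursIn R c) → segment (pred x) y (2 + a) ⊆ R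
segment-widen {D} {R} {x} {y} {suc a} _ seg⊆D neighbours = widened
  where
  left-end : ∀ x → -1ℤ +ᶻ (x +ᶻ 0ℤ) ≡ (-1ℤ +ᶻ x) +ᶻ 0ℤ
  left-end = ℤ-Ring.solve-∀
  inner : ∀ x j → x +ᶻ j ≡ (-1ℤ +ᶻ x) +ᶻ (1ℤ +ᶻ j)
  inner = ℤ-Ring.solve-∀
  right-end : ∀ x j → 1ℤ +ᶻ (x +ᶻ j) ≡ (-1ℤ +ᶻ x) +ᶻ (1ℤ +ᶻ (1ℤ +ᶻ j))
  right-end = ℤ-Ring.solve-∀
  neighbours-of : ∀ {j} → j < suc a → NeighboursIn R (x +ᶻ + j , y)
  neighbours-of j<w = neighbours (seg⊆D (∈-segment⁺ {x} {y} j<w))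
  widened : segment (pred x) y (2 + suc a) ⊆ R
  widened c∈ with ∈-segment⁻ {pred x} {y} {2 + suc a} c∈
  ... | zero , _ , refl =
    subst (_∈ R) (cong (_, y) (left-end x)) (proj₁ (neighbours-of (s≤s z≤n)))
  ... | suc j , s≤s (s≤s j≤1+a) , refl with ℕₚ.m≤n⇒m<n∨m≡n j≤1+a
  ...   | inj₁ j<1+a = subst (_∈ R) (cong (_, y) (inner x (+ j)))
                         (proj₁ (proj₂ (neighbours-of j<1+a)))
  ...   | inj₂ refl  = subst (_∈ R) (cong (_, y) (right-end x (+ a)))
                         (proj₂ (proj₂ (neighbours-of (ℕₚ.n<1+n a))))

-- The ziggurat

zigCell : ℕ → ℕ → Cell
zigCell i j = (+ i -ᶻ + j , - (+ j))

zigRow : ℕ → List Cell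
zigRow j = map (λ i → zigCell i j) (upTo (suc (2 * j)))

∈-ziggurat⁺ : ∀ {M i j} → j < M → i < suc (2 * j) → zigCell i j ∈ ziggurat M
∈-ziggurat⁺ {M} {i} {j} j<M i<w =
  ∈-concatMap⁺ zigRow {xs = upTo M}
    (lose (∈-upTo⁺ j<M) (∈-map⁺ (λ i → zigCell i j) (∈-upTo⁺ i<w)))

∈-ziggurat⁻ : ∀ {M c} → c ∈ ziggurat M →
              ∃[ i ] ∃[ j ] (j < M × i < suc (2 * j) × c ≡ zigCell i j)
∈-ziggurat⁻ {M} c∈
  with j , j∈upTo , c∈row ← find (∈-concatMap⁻ zigRow {xs = upTo M} c∈)
  with i , i∈upTo , refl ← ∈-map⁻ (λ i → zigCell i j) c∈row
  = i , j , ∈-upTo⁻ j∈upTo , ∈-upTo⁻ i∈upTo , refl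

zigRow-unique : ∀ j → Unique (zigRow j)
zigRow-unique j =
  Uniqueₚ.map⁺ (ℤₚ.+-injective ∘ ∙-cancelʳ (- + j) _ _ ∘ cong proj₁) (Uniqueₚ.upTo⁺ _)

ziggurat-suc : ∀ M → ziggurat (suc M) ≡ ziggurat M ++ zigRow M
ziggurat-suc M = begin
  concatMap zigRow (upTo (suc M))        ≡⟨ cong (concatMap zigRow) (upTo-∷ʳ M) ⟨
  concatMap zigRow (upTo M ++ [ M ])     ≡⟨ concatMap-++ zigRow (upTo M) [ M ] ⟩
  ziggurat M ++ (zigRow M ++ [])         ≡⟨ cong (ziggurat M ++_) (++-identityʳ (zigRow M)) ⟩
  ziggurat M ++ zigRow M                 ∎
  where open ≡-Reasoning

length-ziggurat : ∀ M → length (ziggurat M) ≡ M * M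
length-ziggurat zero    = refl
length-ziggurat (suc M) = begin
  length (ziggurat (suc M))                 ≡⟨ cong length (ziggurat-suc M) ⟩
  length (ziggurat M ++ zigRow M)           ≡⟨ length-++ (ziggurat M) ⟩
  length (ziggurat M) + length (zigRow M)   ≡⟨ cong₂ _+_ (length-ziggurat M) length-zigRow ⟩
  M * M + suc (2 * M)                       ≡⟨ next-square M ⟩
  suc M * suc M                             ∎
  where
  open ≡-Reasoning
  length-zigRow = trans (length-map _ (upTo (suc (2 * M)))) (length-upTo _)
  next-square : ∀ M → M * M + suc (2 * M) ≡ suc M * suc M
  next-square = ℕ-Ring.solve-∀

ziggurat-unique : ∀ M → Unique (ziggurat M)
ziggurat-unique zero    = []
ziggurat-unique (suc M) =
  subst Unique (sym (ziggurat-suc M)) (Uniqueₚ.++⁺ (ziggurat-unique M) (zigRow-unique M) rows-differ)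
  where
  rows-differ : ∀ {c} → ¬ (c ∈ ziggurat M × c ∈ zigRow M)
  rows-differ (c∈Z , c∈row)
    with _ , j , j<M , _ , refl ← ∈-ziggurat⁻ c∈Z
    with _ , _ , eq ← ∈-map⁻ (λ i → zigCell i M) c∈row
    = ℕₚ.<⇒≢ j<M (ℤₚ.+-injective (ℤₚ.neg-injective (cong proj₂ eq)))

left-zigCell : ∀ i j → left (zigCell (suc i) j) ≡ zigCell i j
left-zigCell i j = cong (_, - + j) (column (+ i) (+ j))
  where
  column : ∀ i j → -1ℤ +ᶻ ((1ℤ +ᶻ i) -ᶻ j) ≡ i -ᶻ j
  column = ℤ-Ring.solve-∀

right-zigCell : ∀ i j → right (zigCell i j) ≡ zigCell (suc i) j
right-zigCell i j = cong (_, - + j) (column (+ i) (+ j))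
  where
  column : ∀ i j → 1ℤ +ᶻ (i -ᶻ j) ≡ (1ℤ +ᶻ i) -ᶻ j
  column = ℤ-Ring.solve-∀

up-zigCell : ∀ i j → up (zigCell (suc i) (suc j)) ≡ zigCell i j
up-zigCell i j = cong₂ _,_ (column (+ i) (+ j)) (one-up (+ j))
  where
  column : ∀ i j → (1ℤ +ᶻ i) -ᶻ (1ℤ +ᶻ j) ≡ i -ᶻ j
  column = ℤ-Ring.solve-∀
  one-up : ∀ j → 1ℤ +ᶻ - (1ℤ +ᶻ j) ≡ - j
  one-up = ℤ-Ring.solve-∀

down-zigCell : ∀ i j → shift (0ℤ , -1ℤ) (zigCell i j) ≡ zigCell (suc i) (suc j)
down-zigCell i j = cong₂ _,_ (column (+ i) (+ j)) (one-down (+ j))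
  where
  column : ∀ i j → 0ℤ +ᶻ (i -ᶻ j) ≡ (1ℤ +ᶻ i) -ᶻ (1ℤ +ᶻ j)
  column = ℤ-Ring.solve-∀
  one-down : ∀ j → -1ℤ +ᶻ - j ≡ - (1ℤ +ᶻ j)
  one-down = ℤ-Ring.solve-∀

adjacent-by : ∀ c d {dx dy} → proj₁ c -ᶻ proj₁ d ≡ dx → proj₂ c -ᶻ proj₂ d ≡ dy →
              ∣ dx ∣ + ∣ dy ∣ ≡ 1 → Adjacent c d
adjacent-by _ _ refl refl unit = unit

left-adjacent : ∀ c → Adjacent c (left c)
left-adjacent c@(x , y) = adjacent-by c (left c) (dx≡ x) (ℤₚ.+-inverseʳ y) refl
  where
  dx≡ : ∀ x → x -ᶻ (-1ℤ +ᶻ x) ≡ 1ℤ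
  dx≡ = ℤ-Ring.solve-∀

right-adjacent : ∀ c → Adjacent c (right c)
right-adjacent c@(x , y) = adjacent-by c (right c) (dx≡ x) (ℤₚ.+-inverseʳ y) refl
  where
  dx≡ : ∀ x → x -ᶻ (1ℤ +ᶻ x) ≡ -1ℤ
  dx≡ = ℤ-Ring.solve-∀

up-adjacent : ∀ c → Adjacent c (up c)
up-adjacent c@(x , y) = adjacent-by c (up c) (ℤₚ.+-inverseʳ x) (dy≡ y) refl
  where
  dy≡ : ∀ y → y -ᶻ (1ℤ +ᶻ y) ≡ -1ℤ
  dy≡ = ℤ-Ring.solve-∀

walk-start : ∀ {P a b} → Walk P a b → a ∈ P
walk-start (here a∈P)     = a∈P
walk-start (step a∈P _ _) = a∈P

walk-++ : ∀ {P a b c} → Walk P a b → Walk P b c → Walk P a c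
walk-++ (here _)         w = w
walk-++ (step a∈P adj v) w = step a∈P adj (walk-++ v w)

adjacent-sym : ∀ {c d} → Adjacent c d → Adjacent d c
adjacent-sym {x , y} {x′ , y′} adj =
  trans (cong₂ _+_ (ℤₚ.∣i-j∣≡∣j-i∣ x′ x) (ℤₚ.∣i-j∣≡∣j-i∣ y′ y)) adj

walk-reverse : ∀ {P a b} → Walk P a b → Walk P b a
walk-reverse (here a∈P)                = here a∈P
walk-reverse (step {c} {d} c∈P adj w) =
  walk-++ (walk-reverse w) (step (walk-start w) (adjacent-sym {c} {d} adj) (here c∈P))

ziggurat-connected : ∀ M → EdgeConnected (ziggurat M)
ziggurat-connected M a∈Z b∈Z = walk-++ (to-apex a∈Z) (walk-reverse (to-apex b∈Z))
  where
  Z = ziggurat M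
  along-row : ∀ {i j} → j < M → i < suc (2 * j) → Walk Z (zigCell i j) (zigCell 0 j)
  along-row {zero}  j<M i<w = here (∈-ziggurat⁺ j<M i<w)
  along-row {suc i} {j} j<M i<w = step (∈-ziggurat⁺ j<M i<w) (left-adjacent (zigCell (suc i) j))
    (subst (λ c → Walk Z c (zigCell 0 j)) (sym (left-zigCell i j))
      (along-row j<M (ℕₚ.<-trans (ℕₚ.n<1+n i) i<w)))
  up-edge : ∀ {j} → j < M → Walk Z (zigCell 0 j) (zigCell 0 0)
  up-edge {zero}  j<M = here (∈-ziggurat⁺ j<M (s≤s z≤n))
  up-edge {suc j} j<M = step (∈-ziggurat⁺ j<M (s≤s z≤n)) (right-adjacent (zigCell 0 (suc j)))
    (subst (λ c → Walk Z c (zigCell 0 0)) (sym (right-zigCell 0 (suc j)))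
      (step (∈-ziggurat⁺ j<M (s≤s (s≤s z≤n))) (up-adjacent (zigCell 1 (suc j)))
        (subst (λ c → Walk Z c (zigCell 0 0)) (sym (up-zigCell 0 j))
          (up-edge (ℕₚ.<-trans (ℕₚ.n<1+n j) j<M)))))
  to-apex : ∀ {c} → c ∈ Z → Walk Z c (zigCell 0 0)
  to-apex c∈Z with i , j , j<M , i<w , refl ← ∈-ziggurat⁻ c∈Z =
    walk-++ (along-row j<M i<w) (up-edge j<M)

ziggurat-isPolyomino : ∀ M → IsPolyomino (ziggurat (suc M))
ziggurat-isPolyomino M = record
  { nonempty  = zigCell 0 0 , ∈-ziggurat⁺ {suc M} (s≤s z≤n) (s≤s z≤n)
  ; distinct  = ziggurat-unique (suc M)
  ; connected = ziggurat-connected (suc M)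
  }

ziggurat-instances : ∀ N → AtLeastInstances (N ^ 2) (ziggurat (suc N))
ziggurat-instances N =
  centres , Uniqueₚ.map⁺ (shift-injective (0ℤ , -1ℤ)) (ziggurat-unique N) , enough , All.tabulate fits
  where
  Z = ziggurat (suc N)
  centres = map (shift (0ℤ , -1ℤ)) (ziggurat N)
  enough : N ^ 2 ≤ length centres
  enough = ℕₚ.≤-reflexive (begin
    N ^ 2                 ≡⟨ cong (N *_) (ℕₚ.^-identityʳ N) ⟩
    N * N                 ≡⟨ length-ziggurat N ⟨
    length (ziggurat N)   ≡⟨ length-map _ (ziggurat N) ⟨
    length centres        ∎)
    where open ≡-Reasoning
  wider : ∀ {i j} k → k ≤ 2 → i < suc (2 * j) → k + i < suc (2 * suc j)
  wider {i} {j} k k≤2 i<w = subst (λ w → k + i < suc w) (sym (ℕₚ.*-suc 2 j))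
    (s≤s (ℕₚ.+-mono-≤ k≤2 (ℕₚ.≤-pred i<w)))
  fits : ∀ {t} → t ∈ centres → InstanceIn Z t
  fits t∈ with c , c∈Z , refl ← ∈-map⁻ _ t∈
          with i , j , j<N , i<w , refl ← ∈-ziggurat⁻ {N} c∈Z =
    subst (InstanceIn Z) (sym (down-zigCell i j)) (cells⇒instance
      ( subst (_∈ Z) (sym (left-zigCell i (suc j))) (∈-ziggurat⁺ (s≤s j<N) (wider 0 z≤n i<w))
      ∷ ∈-ziggurat⁺ (s≤s j<N) (wider 1 (s≤s z≤n) i<w)
      ∷ subst (_∈ Z) (sym (right-zigCell (suc i) (suc j)))
          (∈-ziggurat⁺ (s≤s j<N) (wider 2 ℕₚ.≤-refl i<w))
      ∷ subst (_∈ Z) (sym (up-zigCell i j)) (∈-ziggurat⁺ (ℕₚ.m<n⇒m<1+n j<N) i<w)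
      ∷ []))

shifted-ziggurat≐Trapezoid : ∀ x y M → (_∈ map (shift (x , y)) (ziggurat M)) ≐ Trapezoid x y 1 M
shifted-ziggurat≐Trapezoid x y M = to , from
  where
  column : ∀ x i j → x +ᶻ (i -ᶻ j) ≡ (x -ᶻ j) +ᶻ i
  column = ℤ-Ring.solve-∀
  cell≡ : ∀ i j → shift (x , y) (zigCell i j) ≡ ((x -ᶻ + j) +ᶻ + i , y -ᶻ + j)
  cell≡ i j = cong (_, y -ᶻ + j) (column x (+ i) (+ j))
  to : ∀ {c} → c ∈ map (shift (x , y)) (ziggurat M) → Trapezoid x y 1 M c
  to c∈ with z , z∈Z , refl ← ∈-map⁻ _ c∈
        with i , j , j<M , i<w , refl ← ∈-ziggurat⁻ {M} z∈Z =
    j , j<M , subst (_∈ segment (x -ᶻ + j) (y -ᶻ + j) (suc (2 * j))) (sym (cell≡ i j))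
                (∈-segment⁺ {x -ᶻ + j} {y -ᶻ + j} i<w)
  from : ∀ {c} → Trapezoid x y 1 M c → c ∈ map (shift (x , y)) (ziggurat M)
  from (j , j<M , c∈) with i , i<w , refl ← ∈-segment⁻ {x -ᶻ + j} {y -ᶻ + j} {suc (2 * j)} c∈ =
    subst (_∈ _) (cell≡ i j) (∈-map⁺ (shift (x , y)) (∈-ziggurat⁺ j<M i<w))

≐Trapezoid⇒IsTranslateOf-ziggurat : ∀ {P x y M} → (_∈ P) ≐ Trapezoid x y 1 M →
                                    IsTranslateOf P (ziggurat M)
≐Trapezoid⇒IsTranslateOf-ziggurat {x = x} {y} {M} (P⊆T , T⊆P) =
  (x , y) , λ _ → (λ c∈P → proj₂ Z≐T (P⊆T c∈P)) , (λ c∈Z → T⊆P (proj₁ Z≐T c∈Z))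
  where
  Z≐T = shifted-ziggurat≐Trapezoid x y M

-- Arithmetic of the final bound

m*m≤n*n⇒m≤n : ∀ {m n} → m * m ≤ n * n → m ≤ n
m*m≤n*n⇒m≤n m²≤n² = ℕₚ.≮⇒≥ λ n<m → ℕₚ.<⇒≱ (ℕₚ.*-mono-< n<m n<m) m²≤n²

sum≡0⇒summands≡0 : ∀ s r m b → s + r + suc m * b ≡ 0 → s ≡ 0 × r ≡ 0 × b ≡ 0
sum≡0⇒summands≡0 zero    zero    m zero    _  = refl , refl , refl
sum≡0⇒summands≡0 zero    zero    m (suc b) ()
sum≡0⇒summands≡0 zero    (suc r) m b       ()
sum≡0⇒summands≡0 (suc s) r       m b       ()

completed-square : ∀ k m s e → k + m + s ≡ m * (suc e + m) →
                   4 * (k + s) + e * e ≡ (2 * m + e) * (2 * m + e)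
completed-square k m s e instances≡ = ℕₚ.+-cancelʳ-≡ (4 * m) _ _ (begin
  4 * (k + s) + e * e + 4 * m     ≡⟨ regroup k s e m ⟩
  4 * (k + m + s) + e * e         ≡⟨ cong (λ z → 4 * z + e * e) instances≡ ⟩
  4 * (m * (suc e + m)) + e * e   ≡⟨ complete m e ⟩
  (2 * m + e) * (2 * m + e) + 4 * m ∎)
  where
  open ≡-Reasoning
  regroup : ∀ k s e m → 4 * (k + s) + e * e + 4 * m ≡ 4 * (k + m + s) + e * e
  regroup = ℕ-Ring.solve-∀
  complete : ∀ m e → 4 * (m * (suc e + m)) + e * e ≡ (2 * m + e) * (2 * m + e) + 4 * m
  complete = ℕ-Ring.solve-∀

double-squared : ∀ N → (2 * N) * (2 * N) ≡ 4 * (N * N)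
double-squared = ℕ-Ring.solve-∀

root-bound : ∀ N k s e {S} → N * N ≤ k → 4 * (k + s) + e * e ≡ S * S → 2 * N ≤ S
root-bound N k s e N²≤k square≡ = m*m≤n*n⇒m≤n (begin
  (2 * N) * (2 * N)     ≡⟨ double-squared N ⟩
  4 * (N * N)           ≤⟨ ℕₚ.*-monoʳ-≤ 4 (ℕₚ.≤-trans N²≤k (ℕₚ.m≤m+n k s)) ⟩
  4 * (k + s)           ≤⟨ ℕₚ.m≤m+n _ (e * e) ⟩
  4 * (k + s) + e * e   ≡⟨ square≡ ⟩
  _                     ∎)
  where open ℕₚ.≤-Reasoning

excess-size : ∀ N t u m e → 2 * N + u ≡ 2 * m + e →
              N * N + t + 2 * m + suc e ≡ suc N * suc N + (t + u)
excess-size N t u m e S≡ = begin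
  N * N + t + 2 * m + suc e     ≡⟨ regroup (N * N) t (2 * m) e ⟩
  N * N + t + (2 * m + e) + 1   ≡⟨ cong (λ S → N * N + t + S + 1) S≡ ⟨
  N * N + t + (2 * N + u) + 1   ≡⟨ expand N t u ⟩
  suc N * suc N + (t + u)       ∎
  where
  open ≡-Reasoning
  regroup : ∀ k t S e → k + t + S + suc e ≡ k + t + (S + e) + 1
  regroup = ℕ-Ring.solve-∀
  expand : ∀ N t u → N * N + t + (2 * N + u) + 1 ≡ suc N * suc N + (t + u)
  expand = ℕ-Ring.solve-∀

no-excess : ∀ {N s m e} → 4 * (N * N + s) + e * e ≡ (2 * m + e) * (2 * m + e) →
            2 * N ≡ 2 * m + e → s ≡ 0 × e ≡ 0 × m ≡ N
no-excess {N} {s} {m} {e} square≡ 2N≡S = s≡0 , e≡0 , m≡N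
  where
  open ≡-Reasoning
  4s+e²≡0 : 4 * s + e * e ≡ 0
  4s+e²≡0 = ℕₚ.+-cancelˡ-≡ (4 * (N * N)) _ _ (begin
    4 * (N * N) + (4 * s + e * e)   ≡⟨ regroup (N * N) s e ⟩
    4 * (N * N + s) + e * e         ≡⟨ square≡ ⟩
    (2 * m + e) * (2 * m + e)       ≡⟨ cong (λ S → S * S) 2N≡S ⟨
    (2 * N) * (2 * N)               ≡⟨ double-squared N ⟩
    4 * (N * N)                     ≡⟨ ℕₚ.+-identityʳ _ ⟨
    4 * (N * N) + 0                 ∎)
    where
    regroup : ∀ k s e → 4 * k + (4 * s + e * e) ≡ 4 * (k + s) + e * e
    regroup = ℕ-Ring.solve-∀
  s≡0 : s ≡ 0
  s≡0 = ℕₚ.*-cancelˡ-≡ s 0 4 (ℕₚ.m+n≡0⇒m≡0 (4 * s) 4s+e²≡0)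
  e≡0 : e ≡ 0
  e≡0 = Sum.reduce (ℕₚ.m*n≡0⇒m≡0∨n≡0 e (ℕₚ.m+n≡0⇒n≡0 (4 * s) 4s+e²≡0))
  m≡N : m ≡ N
  m≡N = ℕₚ.*-cancelˡ-≡ m N 2
          (sym (trans 2N≡S (trans (cong (λ z → 2 * m + z) e≡0) (ℕₚ.+-identityʳ (2 * m)))))

-- With E = e + 1 the instance count gives 4(k + s) + e² = (2m + e)², so k ≥ N² forces 2m + e ≥ 2N;
-- hence k + 2m + e + 1 ≥ (N + 1)², with equality only if k = N², 2m + e = 2N and s = e = 0.
size-excess : ∀ {N k m s E} → N * N ≤ k → 1 ≤ E → k + m + s ≡ m * (E + m) →
              ∃[ excess ] (k + 2 * m + E ≡ suc N * suc N + excess ×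
                           (excess ≡ 0 → s ≡ 0 × E ≡ 1 × m ≡ N))
size-excess {N} {k} {m} {s} {suc e} N²≤k _ instances≡
  with t , refl ← ℕₚ.m≤n⇒∃[o]m+o≡n N²≤k
  with u , 2N+u≡S ← ℕₚ.m≤n⇒∃[o]m+o≡n
                       (root-bound N (N * N + t) s e N²≤k (completed-square (N * N + t) m s e instances≡))
  = t + u , excess-size N t u m e 2N+u≡S , tight
  where
  tight : t + u ≡ 0 → s ≡ 0 × suc e ≡ 1 × m ≡ N
  tight t+u≡0 with refl ← ℕₚ.m+n≡0⇒m≡0 t t+u≡0 | refl ← ℕₚ.m+n≡0⇒n≡0 t t+u≡0
    with s≡0 , e≡0 , m≡N ←
           no-excess (subst (λ k → 4 * (k + s) + e * e ≡ (2 * m + e) * (2 * m + e)) (ℕₚ.+-identityʳ (N * N))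
                       (completed-square (N * N + 0) m s e instances≡))
                     (trans (sym (ℕₚ.+-identityʳ (2 * N))) 2N+u≡S)
    = s≡0 , cong suc e≡0 , m≡N

size-lower-bound : ∀ {N k m s E} → N * N ≤ k → 1 ≤ E → k + m + s ≡ m * (E + m) →
                   suc N * suc N ≤ k + 2 * m + E
size-lower-bound {N} N²≤k 1≤E instances≡ =
  let excess , size≡ , _ = size-excess {N} N²≤k 1≤E instances≡
  in subst (suc N * suc N ≤_) (sym size≡) (ℕₚ.m≤m+n (suc N * suc N) excess)

size-tight : ∀ {N k m s E} → N * N ≤ k → 1 ≤ E → k + m + s ≡ m * (E + m) →
             k + 2 * m + E ≡ suc N * suc N → s ≡ 0 × E ≡ 1 × m ≡ N
size-tight {N} N²≤k 1≤E instances≡ size≡square =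
  let excess , size≡ , tight = size-excess {N} N²≤k 1≤E instances≡
  in tight (ℕₚ.+-cancelˡ-≡ (suc N * suc N) excess 0
             (trans (sym size≡) (trans size≡square (sym (ℕₚ.+-identityʳ _)))))

-- Domination by a trapezoid

-- If P is Trapezoid x y width (suc depth) and C all its instances, then size≡ and instances≡ hold
-- with slack 0: the trapezoid has 2·depth + width more cells than instances, and
-- depth·(width + depth − 1) instances.
record TrapezoidBound (P C : List Cell) (y : ℤ) : Set where
  field
    depth width slack : ℕ
    size≡      : length P ≡ length C + 2 * depth + width
    topRow≤    : length (row y P) ≤ width
    instances≡ : length C + depth + slack ≡ depth * (width + depth)
    tight      : slack ≡ 0 → ∀ x → segment x y width ⊆ P →
                 (_∈ P) ≐ Trapezoid x y width (suc depth)

module StripTopRow {P C : List Cell} {y : ℤ} (P-unique : Unique P) (C-unique : Unique C)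
                   (C-instances : All (InstanceIn P) C) (top : IsTopRow P y) where

  P₀ P′ D C′ R : List Cell
  P₀ = row y P
  P′ = offRow y P
  D  = row (pred y) C
  C′ = offRow (pred y) C
  R  = row (pred y) P′

  p₀ : ℕ
  p₀ = length P₀

  length-P : length P ≡ p₀ + length P′
  length-P = length-filter-∁ (onRow? y) P

  length-C : length C ≡ length D + length C′
  length-C = length-filter-∁ (onRow? (pred y)) C

  P′-unique : Unique P′
  P′-unique = Uniqueₚ.filter⁺ (∁? (onRow? y)) P-unique

  C′-unique : Unique C′
  C′-unique = Uniqueₚ.filter⁺ (∁? (onRow? (pred y))) C-unique

  D-unique : Unique D
  D-unique = Uniqueₚ.filter⁺ (onRow? (pred y)) C-unique

  P′-shorter : length P′ < length P
  P′-shorter = subst (length P′ <_) (sym length-P) (ℕₚ.m<n+m _ (filter-some (onRow? y) (proj₁ top)))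

  below-top : ∀ {c} → c ∈ P → proj₂ c ≢ y → c ∈ P′
  below-top = ∈-filter⁺ (∁? (onRow? y))

  P′-below : ∀ {c} → c ∈ P′ → proj₂ c ≤ᶻ pred y
  P′-below c∈P′ with c∈P , c∉P₀ ← ∈-filter⁻ (∁? (onRow? y)) {xs = P} c∈P′ =
    ℤₚ.i<j⇒i≤pred[j] (ℤₚ.≤∧≢⇒< (All.lookup (proj₂ top) c∈P) c∉P₀)

  T-cells∈P : ∀ {t} → t ∈ C → All (_∈ P) (T-cells t)
  T-cells∈P t∈C = instance⇒cells (All.lookup C-instances t∈C)

  centre-below : ∀ {t} → t ∈ C → proj₂ t <ᶻ y
  centre-below t∈C with _ ∷ _ ∷ _ ∷ up∈P ∷ [] ← T-cells∈P t∈C =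
    ℤₚ.suc[i]≤j⇒i<j (All.lookup (proj₂ top) up∈P)

  centre∈P′ : ∀ {t} → t ∈ C → t ∈ P′
  centre∈P′ t∈C with _ ∷ t∈P ∷ _ ← T-cells∈P t∈C =
    below-top t∈P (ℤₚ.<⇒≢ (centre-below t∈C))

  -- An instance not centred in row y - 1 has its top cell strictly below row y too.
  C′-instances : All (InstanceIn P′) C′
  C′-instances = All.tabulate λ t∈C′ →
    let t∈C , t∉D = ∈-filter⁻ (∁? (onRow? (pred y))) {xs = C} t∈C′ in
    cells⇒instance (restrict t∈C t∉D (T-cells∈P t∈C))
    where
    restrict : ∀ {t} → t ∈ C → proj₂ t ≢ pred y →
               All (_∈ P) (T-cells t) → All (_∈ P′) (T-cells t)
    restrict t∈C t∉D (l ∷ c ∷ r ∷ u ∷ []) =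
      below-top l centre≢y ∷ below-top c centre≢y ∷ below-top r centre≢y ∷ below-top u up≢y ∷ []
      where
      centre≢y = ℤₚ.<⇒≢ (centre-below t∈C)
      up≢y = λ eq → t∉D (trans (sym (ℤₚ.pred-suc _)) (cong pred eq))

  D⊆C : D ⊆ C
  D⊆C d∈D = proj₁ (∈-filter⁻ (onRow? (pred y)) {xs = C} d∈D)

  D-row : ∀ {d} → d ∈ D → proj₂ d ≡ pred y
  D-row d∈D = proj₂ (∈-filter⁻ (onRow? (pred y)) {xs = C} d∈D)

  R⊆P′ : R ⊆ P′
  R⊆P′ c∈R = proj₁ (∈-filter⁻ (onRow? (pred y)) {xs = P′} c∈R)

  P′-top : ∀ {d} → d ∈ D → IsTopRow P′ (pred y)
  P′-top d∈D = lose (centre∈P′ (D⊆C d∈D)) (D-row d∈D) , All.tabulate P′-below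

  D-neighbours : ∀ {d} → d ∈ D → NeighboursIn R d
  D-neighbours d∈D with l ∷ c ∷ r ∷ _ ∷ [] ← T-cells∈P (D⊆C d∈D) =
    into-R l (D-row d∈D) , into-R c (D-row d∈D) , into-R r (D-row d∈D)
    where
    pred≢y : pred y ≢ y
    pred≢y eq = ℤₚ.i≢suc[i] (trans eq (sym (ℤₚ.suc-pred y)))
    into-R : ∀ {c} → c ∈ P → proj₂ c ≡ pred y → c ∈ R
    into-R c∈P row≡ =
      ∈-filter⁺ (onRow? (pred y)) (below-top c∈P (pred≢y ∘ trans (sym row≡))) row≡

  tops⊆P₀ : map up D ⊆ P₀
  tops⊆P₀ c∈ with d , d∈D , refl ← ∈-map⁻ up c∈
             with _ ∷ _ ∷ _ ∷ up∈P ∷ [] ← T-cells∈P (D⊆C d∈D) =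
    ∈-filter⁺ (onRow? y) up∈P (trans (cong sucℤ (D-row d∈D)) (ℤₚ.suc-pred y))

  tops-unique : Unique (map up D)
  tops-unique = Uniqueₚ.map⁺ up-injective D-unique

  centres≤top : length D ≤ p₀
  centres≤top = subst (_≤ p₀) (length-map up D) (Unique-⊆⇒length≤ tops-unique tops⊆P₀)

  -- A top row of at most |D| cells consists exactly of the tops of D, so a segment filling it lies
  -- above a segment of D, whose neighbours fill the row below one cell beyond each end.
  centres-tight : ∀ x {h} → 1 ≤ length D → p₀ ≤ length D → segment x y (length D) ⊆ P →
                  (segment (pred x) (pred y) (2 + length D) ⊆ P′ →
                   (_∈ P′) ≐ Trapezoid (pred x) (pred y) (2 + length D) h) →
                  (_∈ P) ≐ Trapezoid x y (length D) (suc h)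
  centres-tight x 1≤a p₀≤a seg⊆P below =
    Trapezoid-by-rows {x = x} (P₀⊆seg , seg⊆P₀) (below widened)
    where
    a = length D
    seg⊆P₀ : segment x y a ⊆ P₀
    seg⊆P₀ = segment⊆row {x} {y} {a} seg⊆P
    P₀⊆seg : P₀ ⊆ segment x y a
    P₀⊆seg = Unique-⊆-length≥⇒⊇ _≟ᶜ_ (segment-unique x y a) seg⊆P₀
               (subst (p₀ ≤_) (sym (length-segment x y a)) p₀≤a)
    P₀⊆tops : P₀ ⊆ map up D
    P₀⊆tops = Unique-⊆-length≥⇒⊇ _≟ᶜ_ tops-unique tops⊆P₀
                (subst (p₀ ≤_) (sym (length-map up D)) p₀≤a)
    seg⊆D : segment x (pred y) a ⊆ D
    seg⊆D c∈ with j , j<a , refl ← ∈-segment⁻ {x} {pred y} {a} c∈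
             with d , d∈D , eq ← ∈-map⁻ up (P₀⊆tops (seg⊆P₀ (∈-segment⁺ {x} {y} j<a))) =
      subst (_∈ D) (cong₂ _,_ (sym (cong proj₁ eq)) (D-row d∈D)) d∈D
    widened : segment (pred x) (pred y) (2 + a) ⊆ P′
    widened = R⊆P′ ∘ segment-widen {x = x} {pred y} 1≤a seg⊆D D-neighbours

  IH : Set
  IH = ∀ y′ → IsTopRow P′ y′ → TrapezoidBound P′ C′ y′

  single-row : P′ ≡ [] → TrapezoidBound P C y
  single-row P′≡[] = record
    { depth      = 0
    ; width      = length P
    ; slack      = 0
    ; size≡      = cong (λ k → k + 2 * 0 + length P) (sym |C|≡0)
    ; topRow≤    = length-filter (onRow? y) P
    ; instances≡ = cong (λ k → k + 0 + 0) |C|≡0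
    ; tight      = λ _ x seg⊆P →
        ≐-trans (Unique-⊆-length≥⇒⊇ _≟ᶜ_ (segment-unique x y _) seg⊆P
                   (ℕₚ.≤-reflexive (sym (length-segment x y _))) , seg⊆P)
                (≐-sym (Trapezoid-one x y (length P)))
    }
    where
    |C|≡0 : length C ≡ 0
    |C|≡0 = cong length (⊆[]⇒≡[] λ t∈C → subst (_ ∈_) P′≡[] (centre∈P′ t∈C))

  no-centres : IH → ∀ {c} → c ∈ P′ → D ≡ [] → TrapezoidBound P C y
  no-centres ih c∈P′ D≡[] with y′ , top′ ← topRow c∈P′ = record
    { depth      = m
    ; width      = E + p₀
    ; slack      = s + m * p₀
    ; size≡      = begin
        length P                      ≡⟨ length-P ⟩
        p₀ + length P′                ≡⟨ cong (λ n → p₀ + n) Rest.size≡ ⟩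
        p₀ + (length C′ + 2 * m + E)  ≡⟨ move-top p₀ (length C′) m E ⟩
        length C′ + 2 * m + (E + p₀)  ≡⟨ cong (λ k → k + 2 * m + (E + p₀)) |C|≡|C′| ⟨
        length C + 2 * m + (E + p₀)   ∎
    ; topRow≤    = ℕₚ.m≤n+m p₀ E
    ; instances≡ = subst (λ k → k + m + (s + m * p₀) ≡ m * ((E + p₀) + m)) (sym |C|≡|C′|)
                     (widen-slack (length C′) m s E p₀ Rest.instances≡)
    ; tight      = λ _ x seg⊆P →
        contradiction (top-too-short x seg⊆P) (ℕₚ.<⇒≱ (ℕₚ.+-monoˡ-< p₀ 0<E))
    }
    where
    open ≡-Reasoning
    module Rest = TrapezoidBound (ih y′ top′)
    m = Rest.depth
    E = Rest.width
    s = Rest.slack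
    |C|≡|C′| : length C ≡ length C′
    |C|≡|C′| = trans length-C (cong (λ D → length D + length C′) D≡[])
    0<E : 0 < E
    0<E = ℕₚ.<-≤-trans (filter-some (onRow? y′) (proj₁ top′)) Rest.topRow≤
    top-too-short : ∀ x → segment x y (E + p₀) ⊆ P → E + p₀ ≤ p₀
    top-too-short x seg⊆P =
      subst (_≤ p₀) (length-segment x y _)
        (Unique-⊆⇒length≤ (segment-unique x y _) (segment⊆row {x} {y} seg⊆P))
    move-top : ∀ p k m E → p + (k + 2 * m + E) ≡ k + 2 * m + (E + p)
    move-top = ℕ-Ring.solve-∀
    widen-slack : ∀ k m s E p → k + m + s ≡ m * (E + m) → k + m + (s + m * p) ≡ m * ((E + p) + m)
    widen-slack k m s E p instances≡ = begin
      k + m + (s + m * p)       ≡⟨ regroup k m s (m * p) ⟩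
      k + m + s + m * p         ≡⟨ cong (_+ m * p) instances≡ ⟩
      m * (E + m) + m * p       ≡⟨ distribute m E p ⟩
      m * ((E + p) + m)         ∎
      where
      regroup : ∀ k m s q → k + m + (s + q) ≡ k + m + s + q
      regroup = ℕ-Ring.solve-∀
      distribute : ∀ m E p → m * (E + m) + m * p ≡ m * ((E + p) + m)
      distribute = ℕ-Ring.solve-∀

  centres : IH → ∀ {d} → d ∈ D → TrapezoidBound P C y
  centres ih d∈D = from-gaps (ℕₚ.m≤n⇒∃[o]m+o≡n 2+a≤E) (ℕₚ.m≤n⇒∃[o]m+o≡n centres≤top)
    where
    open ≡-Reasoning
    module Rest = TrapezoidBound (ih (pred y) (P′-top d∈D))
    a = length D
    k′ = length C′
    m = Rest.depth
    E = Rest.width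
    s = Rest.slack
    2+a≤E : 2 + a ≤ E
    2+a≤E = ℕₚ.≤-trans (neighbours⇒2+length≤ D-unique d∈D D-neighbours) Rest.topRow≤
    tight : ∀ r b → 2 + a + r ≡ E → a + b ≡ p₀ → s + r + suc m * b ≡ 0 →
            ∀ x → segment x y (r + p₀) ⊆ P → (_∈ P) ≐ Trapezoid x y (r + p₀) (suc (suc m))
    tight r b E≡ p₀≡ slack≡0 x with s≡0 , refl , refl ← sum≡0⇒summands≡0 s r m b slack≡0 =
      subst (λ w → segment x y w ⊆ P → (_∈ P) ≐ Trapezoid x y w (suc (suc m))) a≡p₀ whole
      where
      a≡p₀ : a ≡ p₀
      a≡p₀ = trans (sym (ℕₚ.+-identityʳ a)) p₀≡
      E≡2+a : E ≡ 2 + a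
      E≡2+a = trans (sym E≡) (ℕₚ.+-identityʳ (2 + a))
      rest : segment (pred x) (pred y) (2 + a) ⊆ P′ → (_∈ P′) ≐ Trapezoid (pred x) (pred y) (2 + a) (suc m)
      rest = subst (λ w → segment (pred x) (pred y) w ⊆ P′ → (_∈ P′) ≐ Trapezoid (pred x) (pred y) w (suc m))
                   E≡2+a (Rest.tight s≡0 (pred x))
      whole : segment x y a ⊆ P → (_∈ P) ≐ Trapezoid x y a (suc (suc m))
      whole seg⊆P = centres-tight x (∈-length d∈D) (ℕₚ.≤-reflexive (sym a≡p₀)) seg⊆P rest
    from-gaps : ∃[ r ] (2 + a + r ≡ E) → ∃[ b ] (a + b ≡ p₀) → TrapezoidBound P C y
    from-gaps (r , E≡) (b , p₀≡) = record
      { depth      = suc m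
      ; width      = r + p₀
      ; slack      = s + r + suc m * b
      ; size≡      = begin
          length P                              ≡⟨ length-P ⟩
          p₀ + length P′                        ≡⟨ cong (λ n → p₀ + n) Rest.size≡ ⟩
          p₀ + (k′ + 2 * m + E)                 ≡⟨ cong (λ E → p₀ + (k′ + 2 * m + E)) E≡ ⟨
          p₀ + (k′ + 2 * m + (2 + a + r))       ≡⟨ shift-rows p₀ k′ m a r ⟩
          (a + k′) + 2 * suc m + (r + p₀)       ≡⟨ cong (λ k → k + 2 * suc m + (r + p₀)) length-C ⟨
          length C + 2 * suc m + (r + p₀)       ∎
      ; topRow≤    = ℕₚ.m≤n+m p₀ r
      ; instances≡ = begin
          length C + suc m + slack′          ≡⟨ cong (λ k → k + suc m + slack′) length-C ⟩
          (a + k′) + suc m + slack′          ≡⟨ regroup a k′ m s r b ⟩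
          (k′ + m + s) + extra               ≡⟨ cong (_+ extra) Rest.instances≡ ⟩
          m * (E + m) + extra                ≡⟨ cong (λ E → m * (E + m) + extra) E≡ ⟨
          m * ((2 + a + r) + m) + extra      ≡⟨ add-row m a r b ⟩
          suc m * ((r + (a + b)) + suc m)    ≡⟨ cong (λ p → suc m * ((r + p) + suc m)) p₀≡ ⟩
          suc m * ((r + p₀) + suc m)         ∎
      ; tight      = tight r b E≡ p₀≡
      }
      where
      slack′ = s + r + suc m * b
      extra  = 1 + a + r + suc m * b
      shift-rows : ∀ p k m a r → p + (k + 2 * m + (2 + a + r)) ≡ (a + k) + 2 * suc m + (r + p)
      shift-rows = ℕ-Ring.solve-∀
      regroup : ∀ a k m s r b →
                (a + k) + suc m + (s + r + suc m * b) ≡ (k + m + s) + (1 + a + r + suc m * b)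
      regroup = ℕ-Ring.solve-∀
      add-row : ∀ m a r b →
                m * ((2 + a + r) + m) + (1 + a + r + suc m * b) ≡ suc m * ((r + (a + b)) + suc m)
      add-row = ℕ-Ring.solve-∀

  bound : IH → TrapezoidBound P C y
  bound ih with empty-or-member P′ | empty-or-member D
  ... | inj₁ P′≡[]      | _              = single-row P′≡[]
  ... | inj₂ (_ , c∈P′) | inj₁ D≡[]      = no-centres ih c∈P′ D≡[]
  ... | inj₂ _          | inj₂ (_ , d∈D) = centres ih d∈D

trapezoidBound : ∀ n {P C y} → length P < n → Unique P → Unique C → All (InstanceIn P) C →
                 IsTopRow P y → TrapezoidBound P C y
trapezoidBound (suc n) |P|<1+n P-unique C-unique C-instances top = bound λ _ →
  trapezoidBound n (ℕₚ.<-≤-trans P′-shorter (ℕₚ.≤-pred |P|<1+n)) P′-unique C′-unique C′-instances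
  where open StripTopRow P-unique C-unique C-instances top

ziggurat-minimal : ∀ N {P} → Unique P → ∃[ c ] (c ∈ P) → AtLeastInstances (N ^ 2) P →
                   size (ziggurat (suc N)) ≤ size P ×
                   (size P ≡ size (ziggurat (suc N)) → IsTranslateOf P (ziggurat (suc N)))
ziggurat-minimal N {P} P-unique (c , c∈P) (ts , ts-unique , N²≤ , ts-instances)
  with y , top ← topRow c∈P = lower , equal
  where
  open TrapezoidBound
    (trapezoidBound (suc (length P)) (ℕₚ.n<1+n _) P-unique ts-unique ts-instances top)
  N*N≤k : N * N ≤ length ts
  N*N≤k = subst (_≤ length ts) (cong (N *_) (ℕₚ.^-identityʳ N)) N²≤
  1≤E : 1 ≤ width
  1≤E = ℕₚ.≤-trans (filter-some (onRow? y) (proj₁ top)) topRow≤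
  lower : size (ziggurat (suc N)) ≤ size P
  lower = subst₂ _≤_ (sym (length-ziggurat (suc N))) (sym size≡)
            (size-lower-bound {N} N*N≤k 1≤E instances≡)
  equal : size P ≡ size (ziggurat (suc N)) → IsTranslateOf P (ziggurat (suc N))
  equal |P|≡|Z| with a , a∈P , a-row ← find (proj₁ top)
    with s≡0 , E≡1 , m≡N ← size-tight {N} N*N≤k 1≤E instances≡
                              (trans (sym size≡) (trans |P|≡|Z| (length-ziggurat (suc N)))) =
    ≐Trapezoid⇒IsTranslateOf-ziggurat {P} {proj₁ a} {y}
      (subst₂ (λ w h → (_∈ P) ≐ Trapezoid (proj₁ a) y w (suc h)) E≡1 m≡N
        (tight s≡0 (proj₁ a) (subst (λ w → segment (proj₁ a) y w ⊆ P) (sym E≡1) apex)))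
    where
    apex : segment (proj₁ a) y 1 ⊆ P
    apex c∈ with _ , s≤s z≤n , refl ← ∈-segment⁻ {proj₁ a} {y} {1} c∈ =
      subst (_∈ P) (cong₂ _,_ (sym (ℤₚ.+-identityʳ _)) a-row) a∈P

theorem5p1 : (N : ℕ) → 1 ≤ N →
    IsPolyomino (ziggurat (suc N)) ×
    AtLeastInstances (N ^ 2) (ziggurat (suc N)) ×
    ((P : List Cell) → IsPolyomino P → AtLeastInstances (N ^ 2) P →
      size (ziggurat (suc N)) ≤ size P ×
      (size P ≡ size (ziggurat (suc N)) → IsTranslateOf P (ziggurat (suc N))))
theorem5p1 N _ =
  ziggurat-isPolyomino N ,
  ziggurat-instances N ,
  λ P P-polyomino →
    ziggurat-minimal N (IsPolyomino.distinct P-polyomino) (IsPolyomino.nonempty P-polyomino)
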